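{- Let $B=(b_{st})$ be an $n\times n$ complex matrix and $1\le k\le n$. Then $$(n^2-n)\,d_{(k,1^{n-k})}(B)=\sum_{1\le i,j\le n}d_{(k,1^{n-k})}(B_{ij}).$$
   Context: For a partition $\lambda$ of $n$ with irreducible character $\chi_\lambda$ of $S_n$, $d_\lambda(B)=\sum_{\sigma\in S_n}\chi_\lambda(\sigma)\prod_{i=1}^n b_{i\sigma(i)}$. For $1\le i,j\le n$, $B_{ij}$ denotes the matrix obtained from $B$ by replacing the $(i,j)$ entry by $0$ and leaving all other entries unchanged. -}

module Defs where

open import Level using (Level)
open import Algebra.Bundles using (CommutativeRing)
open import Data.Bool using (Bool; true; false; if_then_else_; _∧_; _∨_; not)
open import Data.Nat using (ℕ; zero; suc; _∸_; _≤ᵇ_)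
import Data.Nat as ℕ
open import Data.Fin using (Fin; zero; suc; _≟_; _<?_)
open import Data.Vec.Functional using (_∷_)
open import Relation.Nullary.Decidable using (does)

count : (n : ℕ) → (Fin n → Bool) → ℕ
count zero    p = zero
count (suc n) p = (if p zero then 1 else 0) ℕ.+ count n (λ i → p (suc i))

allFin : (n : ℕ) → (Fin n → Bool) → Bool
allFin zero    p = true
allFin (suc n) p = p zero ∧ allFin n (λ i → p (suc i))

-- σ : Fin n → Fin n is a permutation iff it is injective (n finite).
isPerm : {n : ℕ} → (Fin n → Fin n) → Bool
isPerm {n} σ = allFin n λ i → allFin n λ j → does (i ≟ j) ∨ not (does (σ i ≟ σ j))

invariant : {n : ℕ} → (Fin n → Bool) → (Fin n → Fin n) → Bool
invariant {n} S σ = allFin n λ i → not (S i) ∨ S (σ i)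

sumℕ : (n : ℕ) → (Fin n → ℕ) → ℕ
sumℕ zero    f = zero
sumℕ (suc n) f = f zero ℕ.+ sumℕ n (λ i → f (suc i))

invOn : {n : ℕ} → (Fin n → Bool) → (Fin n → Fin n) → ℕ
invOn {n} S σ = sumℕ n λ i → count n λ j → S i ∧ S j ∧ does (i <? j) ∧ does (σ j <? σ i)

module WithRing {c ℓ : Level} (R : CommutativeRing c ℓ) where
  open CommutativeRing R using (Carrier; 0#; 1#; _+_; _*_; -_)

  ΣFin : (n : ℕ) → (Fin n → Carrier) → Carrier
  ΣFin zero    f = 0#
  ΣFin (suc n) f = f zero + ΣFin n (λ i → f (suc i))

  ΠFin : (n : ℕ) → (Fin n → Carrier) → Carrier
  ΠFin zero    f = 1#
  ΠFin (suc n) f = f zero * ΠFin n (λ i → f (suc i))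

  ΣFun : {A : Set} → ((A → Carrier) → Carrier) → (m : ℕ) → ((Fin m → A) → Carrier) → Carrier
  ΣFun sumA zero    F = F (λ ())
  ΣFun sumA (suc m) F = sumA (λ a → ΣFun sumA m (λ g → F (a ∷ g)))

  ΣBool : (Bool → Carrier) → Carrier
  ΣBool F = F true + F false

  sign : ℕ → Carrier
  sign zero    = 1#
  sign (suc m) = - sign m

  natMul : ℕ → Carrier → Carrier
  natMul zero    x = 0#
  natMul (suc m) x = x + natMul m x

  -- Character χ_{(k,1^{n-k})}(σ) of the hook representation, realised as the
  -- character of Λ^{n-k} of the standard representation:
  --   χ(σ) = Σ_{i=0}^{n-k} (-1)^{n-k-i} tr(σ | Λ^i ℂ^n),
  --   tr(σ | Λ^i ℂ^n) = Σ_{|S| = i, σ(S) ⊆ S} sgn(σ|_S).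
  hookChar : (n k : ℕ) → (Fin n → Fin n) → Carrier
  hookChar n k σ = ΣFun ΣBool n λ S →
    if invariant S σ ∧ (count n S ≤ᵇ (n ∸ k))
    then sign (((n ∸ k) ∸ count n S) ℕ.+ invOn S σ)
    else 0#

  hookImmanant : (n k : ℕ) → (Fin n → Fin n → Carrier) → Carrier
  hookImmanant n k B = ΣFun (ΣFin n) n λ σ →
    if isPerm σ then hookChar n k σ * ΠFin n (λ i → B i (σ i)) else 0#

  -- B_{ij}: replace the (i,j) entry of B by 0.
  zeroEntry : {n : ℕ} → (Fin n → Fin n → Carrier) → Fin n → Fin n → Fin n → Fin n → Carrier
  zeroEntry B i j s t = if does (s ≟ i) ∧ does (t ≟ j) then 0# else B s t

-- Expanding d_χ(B_ij) as a sum over maps σ, the monomial χ(σ) Π_s b_{sσ(s)} is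
-- unchanged when j ≠ σ(i) and vanishes when j = σ(i).  So each monomial of d_χ(B)
-- survives in exactly n(n − 1) of the n² matrices B_ij, for any weight χ.
module Submission where

open import Defs
open import Level using (Level)
open import Algebra.Bundles using (CommutativeRing)
open import Data.Nat using (ℕ; zero; suc; _∸_; _≤_)
import Data.Nat as ℕ
import Data.Nat.Properties as ℕₚ
open import Data.Fin using (Fin; zero; suc; _≟_)
open import Data.Bool using (Bool; true; false; if_then_else_; _∧_)
open import Data.Vec.Functional using (_∷_)
open import Relation.Nullary.Decidable using (does)
import Relation.Binary.PropositionalEquality as ≡
import Algebra.Properties.CommutativeMonoid.Sum as CommutativeMonoidSum
import Algebra.Properties.Monoid.Mult as MonoidMult
import Relation.Binary.Reasoning.Setoid as SetoidReasoning

module _ {c ℓ : Level} (R : CommutativeRing c ℓ) where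
  open CommutativeRing R hiding (zero)
  open WithRing R
  open CommutativeMonoidSum +-commutativeMonoid using (sum; sum-cong-≗; sum-replicate; ∑-comm)
  open MonoidMult +-monoid using (_×_; ×-assocˡ)
  open SetoidReasoning setoid

  ΣFin≡sum : (n : ℕ) (f : Fin n → Carrier) → ΣFin n f ≡.≡ sum f
  ΣFin≡sum zero    f = ≡.refl
  ΣFin≡sum (suc n) f = ≡.cong (f zero +_) (ΣFin≡sum n (λ i → f (suc i)))

  natMul≡× : (m : ℕ) (x : Carrier) → natMul m x ≡.≡ m × x
  natMul≡× zero    x = ≡.refl
  natMul≡× (suc m) x = ≡.cong (x +_) (natMul≡× m x)

  natMul-cong : (m : ℕ) {x y : Carrier} → x ≈ y → natMul m x ≈ natMul m y
  natMul-cong zero    x≈y = refl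
  natMul-cong (suc m) x≈y = +-cong x≈y (natMul-cong m x≈y)

  natMul-assoc : (m n : ℕ) (x : Carrier) → natMul m (natMul n x) ≈ natMul (m ℕ.* n) x
  natMul-assoc m n x = begin
    natMul m (natMul n x) ≡⟨ ≡.trans (≡.cong (natMul m) (natMul≡× n x)) (natMul≡× m (n × x)) ⟩
    m × (n × x)           ≈⟨ ×-assocˡ x m n ⟩
    (m ℕ.* n) × x         ≡⟨ natMul≡× (m ℕ.* n) x ⟨
    natMul (m ℕ.* n) x    ∎

  ΣFin-cong : (n : ℕ) {f g : Fin n → Carrier} → (∀ i → f i ≈ g i) → ΣFin n f ≈ ΣFin n g
  ΣFin-cong zero    f≈g = refl
  ΣFin-cong (suc n) f≈g = +-cong (f≈g zero) (ΣFin-cong n (λ i → f≈g (suc i)))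

  ΣFin-const : (n : ℕ) (x : Carrier) → ΣFin n (λ _ → x) ≈ natMul n x
  ΣFin-const n x = begin
    ΣFin n (λ _ → x)  ≡⟨ ΣFin≡sum n (λ _ → x) ⟩
    sum {n} (λ _ → x) ≈⟨ sum-replicate n ⟩
    n × x             ≡⟨ natMul≡× n x ⟨
    natMul n x        ∎

  ΣFin-comm : (m n : ℕ) (f : Fin m → Fin n → Carrier) →
    ΣFin m (λ i → ΣFin n (f i)) ≈ ΣFin n (λ j → ΣFin m (λ i → f i j))
  ΣFin-comm m n f = begin
    ΣFin m (λ i → ΣFin n (f i))           ≡⟨ ΣFin≡sum m _ ⟩
    sum (λ i → ΣFin n (f i))              ≡⟨ sum-cong-≗ (λ i → ΣFin≡sum n (f i)) ⟩
    sum (λ i → sum (f i))                 ≈⟨ ∑-comm f ⟩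
    sum (λ j → sum (λ i → f i j))         ≡⟨ sum-cong-≗ (λ j → ΣFin≡sum m (λ i → f i j)) ⟨
    sum (λ j → ΣFin m (λ i → f i j))      ≡⟨ ΣFin≡sum n _ ⟨
    ΣFin n (λ j → ΣFin m (λ i → f i j))   ∎

  ΣFin-const-except : (n : ℕ) (a : Fin n) (x : Carrier) →
    ΣFin n (λ j → if does (a ≟ j) then 0# else x) ≈ natMul (n ∸ 1) x
  ΣFin-const-except (suc n)       zero    x = trans (+-identityˡ _) (ΣFin-const n x)
  ΣFin-const-except (suc (suc n)) (suc a) x = +-cong refl (ΣFin-const-except (suc n) a x)

  ΠFin-zeroAt : (n : ℕ) (i : Fin n) (e : Fin n → Bool) (f : Fin n → Carrier) →
    ΠFin n (λ s → if does (s ≟ i) ∧ e s then 0# else f s) ≈ (if e i then 0# else ΠFin n f)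
  ΠFin-zeroAt (suc n) zero e f with e zero
  ... | true  = zeroˡ _
  ... | false = refl
  ΠFin-zeroAt (suc n) (suc i) e f with e (suc i) | ΠFin-zeroAt n i (λ s → e (suc s)) (λ s → f (suc s))
  ... | true  | ih = trans (*-cong refl ih) (zeroʳ _)
  ... | false | ih = *-cong refl ih

  *-if-0# : (b : Bool) (x y : Carrier) → x * (if b then 0# else y) ≈ (if b then 0# else x * y)
  *-if-0# true  x y = zeroʳ x
  *-if-0# false x y = refl

  if-then-*-else-0# : (b : Bool) (x y : Carrier) → (if b then x * y else 0#) ≈ (if b then x else 0#) * y
  if-then-*-else-0# true  x y = refl
  if-then-*-else-0# false x y = sym (zeroˡ y)

  ΣFun-cong : (p m : ℕ) {F G : (Fin m → Fin p) → Carrier} → (∀ g → F g ≈ G g) →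
    ΣFun (ΣFin p) m F ≈ ΣFun (ΣFin p) m G
  ΣFun-cong p zero    F≈G = F≈G _
  ΣFun-cong p (suc m) F≈G = ΣFin-cong p (λ a → ΣFun-cong p m (λ g → F≈G (a ∷ g)))

  ΣFin-ΣFun-comm : (n p m : ℕ) (F : Fin n → (Fin m → Fin p) → Carrier) →
    ΣFin n (λ i → ΣFun (ΣFin p) m (F i)) ≈ ΣFun (ΣFin p) m (λ g → ΣFin n (λ i → F i g))
  ΣFin-ΣFun-comm n p zero    F = refl
  ΣFin-ΣFun-comm n p (suc m) F = begin
    ΣFin n (λ i → ΣFin p (λ a → ΣFun (ΣFin p) m (λ g → F i (a ∷ g))))
      ≈⟨ ΣFin-comm n p _ ⟩
    ΣFin p (λ a → ΣFin n (λ i → ΣFun (ΣFin p) m (λ g → F i (a ∷ g))))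
      ≈⟨ ΣFin-cong p (λ a → ΣFin-ΣFun-comm n p m (λ i g → F i (a ∷ g))) ⟩
    ΣFun (ΣFin p) (suc m) (λ g → ΣFin n (λ i → F i g)) ∎

  natMul-ΣFun : (N p m : ℕ) (F : (Fin m → Fin p) → Carrier) →
    natMul N (ΣFun (ΣFin p) m F) ≈ ΣFun (ΣFin p) m (λ g → natMul N (F g))
  natMul-ΣFun N p m F = begin
    natMul N (ΣFun (ΣFin p) m F)                 ≈⟨ ΣFin-const N _ ⟨
    ΣFin N (λ _ → ΣFun (ΣFin p) m F)             ≈⟨ ΣFin-ΣFun-comm N p m (λ _ → F) ⟩
    ΣFun (ΣFin p) m (λ g → ΣFin N (λ _ → F g))   ≈⟨ ΣFun-cong p m (λ g → ΣFin-const N (F g)) ⟩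
    ΣFun (ΣFin p) m (λ g → natMul N (F g))       ∎

  matrixFunction : (n : ℕ) → ((Fin n → Fin n) → Carrier) → (Fin n → Fin n → Carrier) → Carrier
  matrixFunction n χ B = ΣFun (ΣFin n) n (λ σ → χ σ * ΠFin n (λ i → B i (σ i)))

  hookImmanant≈matrixFunction : (n k : ℕ) (B : Fin n → Fin n → Carrier) →
    hookImmanant n k B ≈ matrixFunction n (λ σ → if isPerm σ then hookChar n k σ else 0#) B
  hookImmanant≈matrixFunction n k B =
    ΣFun-cong n n (λ σ → if-then-*-else-0# (isPerm σ) (hookChar n k σ) _)

  ΣFin²-zeroEntry-monomial : (n : ℕ) (x : Carrier) (σ : Fin n → Fin n) (B : Fin n → Fin n → Carrier) →
    ΣFin n (λ i → ΣFin n (λ j → x * ΠFin n (λ s → zeroEntry B i j s (σ s))))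
      ≈ natMul (n ℕ.* n ∸ n) (x * ΠFin n (λ s → B s (σ s)))
  ΣFin²-zeroEntry-monomial n x σ B = begin
    ΣFin n (λ i → ΣFin n (λ j → x * ΠFin n (λ s → zeroEntry B i j s (σ s))))
      ≈⟨ ΣFin-cong n (λ i → ΣFin-cong n (λ j → monomial-zeroEntry i j)) ⟩
    ΣFin n (λ i → ΣFin n (λ j → if does (σ i ≟ j) then 0# else X))
      ≈⟨ ΣFin-cong n (λ i → ΣFin-const-except n (σ i) X) ⟩
    ΣFin n (λ _ → natMul (n ∸ 1) X)
      ≈⟨ ΣFin-const n _ ⟩
    natMul n (natMul (n ∸ 1) X)
      ≈⟨ natMul-assoc n (n ∸ 1) X ⟩
    natMul (n ℕ.* (n ∸ 1)) X
      ≡⟨ ≡.cong (λ m → natMul m X) n*[n∸1]≡n*n∸n ⟩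
    natMul (n ℕ.* n ∸ n) X ∎
    where
    X : Carrier
    X = x * ΠFin n (λ s → B s (σ s))

    monomial-zeroEntry : ∀ i j →
      x * ΠFin n (λ s → zeroEntry B i j s (σ s)) ≈ (if does (σ i ≟ j) then 0# else X)
    monomial-zeroEntry i j = trans (*-cong refl (ΠFin-zeroAt n i (λ s → does (σ s ≟ j)) _))
                                   (*-if-0# (does (σ i ≟ j)) x _)

    n*[n∸1]≡n*n∸n : n ℕ.* (n ∸ 1) ≡.≡ n ℕ.* n ∸ n
    n*[n∸1]≡n*n∸n = ≡.trans (ℕₚ.*-distribˡ-∸ n n 1) (≡.cong (n ℕ.* n ∸_) (ℕₚ.*-identityʳ n))

  natMul-matrixFunction-zeroEntry : (n : ℕ) (χ : (Fin n → Fin n) → Carrier) (B : Fin n → Fin n → Carrier) →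
    natMul (n ℕ.* n ∸ n) (matrixFunction n χ B)
      ≈ ΣFin n (λ i → ΣFin n (λ j → matrixFunction n χ (zeroEntry B i j)))
  natMul-matrixFunction-zeroEntry n χ B = begin
    natMul (n ℕ.* n ∸ n) (matrixFunction n χ B)
      ≈⟨ natMul-ΣFun (n ℕ.* n ∸ n) n n _ ⟩
    ΣFun (ΣFin n) n (λ σ → natMul (n ℕ.* n ∸ n) (χ σ * ΠFin n (λ s → B s (σ s))))
      ≈⟨ ΣFun-cong n n (λ σ → sym (ΣFin²-zeroEntry-monomial n (χ σ) σ B)) ⟩
    ΣFun (ΣFin n) n (λ σ → ΣFin n (λ i → ΣFin n (λ j → term i j σ)))
      ≈⟨ ΣFin-ΣFun-comm n n n (λ i σ → ΣFin n (λ j → term i j σ)) ⟨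
    ΣFin n (λ i → ΣFun (ΣFin n) n (λ σ → ΣFin n (λ j → term i j σ)))
      ≈⟨ ΣFin-cong n (λ i → ΣFin-ΣFun-comm n n n (term i)) ⟨
    ΣFin n (λ i → ΣFin n (λ j → matrixFunction n χ (zeroEntry B i j))) ∎
    where
    term : Fin n → Fin n → (Fin n → Fin n) → Carrier
    term i j σ = χ σ * ΠFin n (λ s → zeroEntry B i j s (σ s))

-- The identity holds for every weight χ.
lemma2p3 : {c ℓ : Level} (R : CommutativeRing c ℓ) →
    let open CommutativeRing R
        open WithRing R
    in (n k : ℕ) → 1 ≤ k → k ≤ n → (B : Fin n → Fin n → Carrier) →
       natMul (n ℕ.* n ∸ n) (hookImmanant n k B)
         ≈ ΣFin n (λ i → ΣFin n (λ j → hookImmanant n k (zeroEntry B i j)))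
lemma2p3 R n k _ _ B = begin
  natMul (n ℕ.* n ∸ n) (hookImmanant n k B)
    ≈⟨ natMul-cong R (n ℕ.* n ∸ n) (hookImmanant≈matrixFunction R n k B) ⟩
  natMul (n ℕ.* n ∸ n) (matrixFunction R n χ B)
    ≈⟨ natMul-matrixFunction-zeroEntry R n χ B ⟩
  ΣFin n (λ i → ΣFin n (λ j → matrixFunction R n χ (zeroEntry B i j)))
    ≈⟨ ΣFin-cong R n (λ i → ΣFin-cong R n (λ j → hookImmanant≈matrixFunction R n k (zeroEntry B i j))) ⟨
  ΣFin n (λ i → ΣFin n (λ j → hookImmanant n k (zeroEntry B i j))) ∎
  where
  open CommutativeRing R using (setoid; _≈_; 0#)
  open WithRing R
  open SetoidReasoning setoid
  χ : (Fin n → Fin n) → CommutativeRing.Carrier R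
  χ σ = if isPerm σ then hookChar n k σ else 0#
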